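{- Let $\mathfrak{F}_1=\langle W_1,R_1\rangle$ and $\mathfrak{F}_2=\langle W_2,R_2\rangle$ be $\mathbf{S4}$ frames with $W_1\cap W_2=\emptyset$, and let $n\ge1$. If for every $1\le m\le n$ both $\mathfrak{F}_1$ and $\mathfrak{F}_2$ satisfy $(su_m)$, then the connected product $\mathfrak{F}_1\otimes\mathfrak{F}_2$ satisfies $(su_n)$.
   Context: An $\mathbf{S4}$ frame is a set with a reflexive transitive relation. The connected product $\mathfrak{F}_1\otimes\mathfrak{F}_2=\langle W,R\rangle$ has $W=W_1\cup W_2\cup(W_1\times W_2)$ (assumed disjoint union) and $R=R_1\cup R_2\cup\{\langle\langle w_1,w_2\rangle,t\rangle : w_1R_1t$, or $w_2R_2t$, or $t=\langle v_1,v_2\rangle$ for some $v_1,v_2$ with $w_1R_1v_1$ and $w_2R_2v_2\}$. In a frame $\langle W,R\rangle$, for $X\subseteq W$: $\mathord{\uparrow}X=\{w:\exists x\in X,\ xRw\}$, $\Diamond X=\{w:\exists x\in X,\ wRx\}$, $\Box X=\{w:\forall v(wRv\Rightarrow v\in X)\}$. For $k\ge1$, $z$ strongly unites $x_0,\dots,x_{k-1}$ if for every $i<k$: $zRx_i$ and $z\in\Box\big(\mathord{\uparrow}\{x_i\}\cup\bigcup_{i'\in k\setminus\{i\}}\Diamond\mathord{\uparrow}\{x_{i'}\}\big)$. A frame satisfies $(su_k)$ if for every point $w$ and all $x_0,\dots,x_{k-1}$ with $wRx_i$ for all $i$, there is $z$ with $wRz$ strongly uniting $x_0,\dots,x_{k-1}$.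 -}

module Defs where

open import Level using (Level; _⊔_; suc)
open import Data.Nat using (ℕ; _≤_)
open import Data.Fin using (Fin)
open import Data.Product using (Σ; ∃; _×_; _,_)
open import Data.Sum using (_⊎_)
open import Relation.Binary.PropositionalEquality using (_≡_; _≢_)
open import Relation.Unary using (Pred)

record S4Frame : Set₁ where
  field
    W     : Set
    R     : W → W → Set
    reflR : ∀ w → R w w
    transR : ∀ {u v w} → R u v → R v w → R u w

open S4Frame public

module _ {W : Set} (R : W → W → Set) where
  up : Pred W Level.zero → Pred W Level.zero
  up X w = ∃ λ x → X x × R x w

  dia : Pred W Level.zero → Pred W Level.zero
  dia X w = ∃ λ x → X x × R w x

  box : Pred W Level.zero → Pred W Level.zero
  box X w = ∀ v → R w v → X v

  sing : W → Pred W Level.zero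
  sing x y = x ≡ y

  StronglyUnites : (k : ℕ) → W → (Fin k → W) → Set
  StronglyUnites k z x =
    ∀ (i : Fin k) →
      R z (x i) ×
      box (λ v → up (sing (x i)) v ⊎
                 (∃ λ (i' : Fin k) → i' ≢ i × dia (up (sing (x i'))) v)) z

data ProdW (F₁ F₂ : S4Frame) : Set where
  inl  : W F₁ → ProdW F₁ F₂
  inr  : W F₂ → ProdW F₁ F₂
  pair : W F₁ → W F₂ → ProdW F₁ F₂

data ProdR (F₁ F₂ : S4Frame) : ProdW F₁ F₂ → ProdW F₁ F₂ → Set where
  r₁ : ∀ {a b} → R F₁ a b → ProdR F₁ F₂ (inl a) (inl b)
  r₂ : ∀ {a b} → R F₂ a b → ProdR F₁ F₂ (inr a) (inr b)
  p₁ : ∀ {w₁ w₂ t} → R F₁ w₁ t → ProdR F₁ F₂ (pair w₁ w₂) (inl t)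
  p₂ : ∀ {w₁ w₂ t} → R F₂ w₂ t → ProdR F₁ F₂ (pair w₁ w₂) (inr t)
  pp : ∀ {w₁ w₂ v₁ v₂} → R F₁ w₁ v₁ → R F₂ w₂ v₂ →
       ProdR F₁ F₂ (pair w₁ w₂) (pair v₁ v₂)

-- The connected product as a bare frame (carrier + relation).
-- (It is reflexive and transitive, but the statement only needs ⟨W,R⟩.)
record Frame : Set₁ where
  field
    FW : Set
    FR : FW → FW → Set

-- The frame property (su_k) of a frame ⟨W,R⟩ (intended for k ≥ 1).
SU : ℕ → Frame → Set
SU k F = ∀ (w : Frame.FW F) (x : Fin k → Frame.FW F) → (∀ i → Frame.FR F w (x i)) →
          ∃ λ z → Frame.FR F w z × StronglyUnites (Frame.FR F) k z x

⌊_⌋ : S4Frame → Frame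
⌊ F ⌋ = record { FW = W F ; FR = R F }

_⊗_ : S4Frame → S4Frame → Frame
F₁ ⊗ F₂ = record { FW = ProdW F₁ F₂ ; FR = ProdR F₁ F₂ }

{-# OPTIONS --safe #-}
-- At a point ⟨a,b⟩ of the product, the xᵢ having a W₁-coordinate (those in W₁ or W₁ × W₂) have
-- their coordinates strongly united in 𝔉₁ by (su_m), m being their number, and likewise in 𝔉₂.
-- The pair ⟨z₁,z₂⟩ of the two uniting points strongly unites all xᵢ: a successor of it lies above
-- xᵢ unless one of its coordinates has a common successor with that coordinate of some other xⱼ,
-- and an xᵢ lacking a coordinate is covered by any xⱼ having one, by reflexivity. When all xᵢ lie
-- in W₁ (as they do below a point of W₁), the uniting point of 𝔉₁ alone does it, and dually.
module Submission where

open import Defs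
open import Data.Nat using (ℕ; _≤_; zero; suc; z≤n; s≤s; >-nonZero⁻¹)
open import Data.Nat.Properties using (m≤n⇒m≤1+n)
open import Data.Fin using (Fin; zero; suc; fromℕ<)
open import Data.Fin.Properties using (suc-injective; nonZeroIndex)
open import Data.Maybe using (Maybe; just; nothing)
open import Data.Product using (_×_; _,_; proj₁; proj₂; ∃; ∃₂)
open import Data.Sum using (_⊎_; inj₁; inj₂; [_,_])
open import Data.Vec.Functional using (_∷_)
open import Function using (_∘_)
open import Function.Definitions using (Injective)
open import Relation.Binary.PropositionalEquality using (_≡_; _≢_; refl; sym; trans; cong)

all-nothing⊎some-just : ∀ {A : Set} {n} (y : Fin n → Maybe A) →
                        (∀ i → y i ≡ nothing) ⊎ (∃₂ λ i c → y i ≡ just c)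
all-nothing⊎some-just {n = zero} y = inj₁ λ ()
all-nothing⊎some-just {n = suc n} y with y zero in y₀ | all-nothing⊎some-just (y ∘ suc)
... | just c  | _                 = inj₂ (zero , c , y₀)
... | nothing | inj₂ (i , c , yi) = inj₂ (suc i , c , yi)
... | nothing | inj₁ rest         = inj₁ λ { zero → y₀ ; (suc i) → rest i }

record Enumeration {A : Set} {n : ℕ} (y : Fin n → Maybe A) : Set where
  field
    size            : ℕ
    index           : Fin size → Fin n
    value           : Fin size → A
    index-injective : Injective _≡_ _≡_ index
    index-value     : ∀ k → y (index k) ≡ just (value k)
    index-complete  : ∀ {i c} → y i ≡ just c → ∃ λ k → index k ≡ i
    size≤n          : size ≤ n

module _ {A : Set} {n : ℕ} {y : Fin (suc n) → Maybe A} (E : Enumeration (y ∘ suc)) where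
  open Enumeration E

  skip-zero : y zero ≡ nothing → Enumeration y
  skip-zero y₀ = record
    { size            = size
    ; index           = suc ∘ index
    ; value           = value
    ; index-injective = index-injective ∘ suc-injective
    ; index-value     = index-value
    ; index-complete  = complete
    ; size≤n          = m≤n⇒m≤1+n size≤n
    }
    where
    complete : ∀ {i c} → y i ≡ just c → ∃ λ k → suc (index k) ≡ i
    complete {zero}  yi with () ← trans (sym y₀) yi
    complete {suc i} yi = let k , k↦i = index-complete yi in k , cong suc k↦i

  keep-zero : ∀ {c} → y zero ≡ just c → Enumeration y
  keep-zero {c} y₀ = record
    { size            = suc size
    ; index           = zero ∷ suc ∘ index
    ; value           = c ∷ value
    ; index-injective = injective
    ; index-value     = λ { zero → y₀ ; (suc k) → index-value k }
    ; index-complete  = complete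
    ; size≤n          = s≤s size≤n
    }
    where
    injective : Injective _≡_ _≡_ (zero ∷ suc ∘ index)
    injective {zero}  {zero}   _ = refl
    injective {suc k} {suc k'} p = cong suc (index-injective (suc-injective p))
    complete : ∀ {i c} → y i ≡ just c → ∃ λ k → (zero ∷ suc ∘ index) k ≡ i
    complete {zero}  _  = zero , refl
    complete {suc i} yi = let k , k↦i = index-complete yi in suc k , cong suc k↦i

enumerate : ∀ {A : Set} {n} (y : Fin n → Maybe A) → Enumeration y
enumerate {n = zero} y = record
  { size            = 0
  ; index           = λ ()
  ; value           = λ ()
  ; index-injective = λ { {()} }
  ; index-value     = λ ()
  ; index-complete  = λ { {()} }
  ; size≤n          = z≤n
  }
enumerate {n = suc n} y with y zero in y₀
... | nothing = skip-zero (enumerate (y ∘ suc)) y₀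
... | just _  = keep-zero (enumerate (y ∘ suc)) y₀

module _ {A : Set} (R : A → A → Set) where

  Covered : ∀ {k} → (Fin k → A) → Fin k → A → Set
  Covered x i v = up R (sing R (x i)) v ⊎ (∃ λ i' → i' ≢ i × dia R (up R (sing R (x i'))) v)

  CoveredPartial : ∀ {n} → (Fin n → Maybe A) → Fin n → A → Set
  CoveredPartial y i t = (∃ λ c → y i ≡ just c × R c t)
                       ⊎ (∃ λ j → j ≢ i × ∃ λ c → y j ≡ just c × dia R (up R (sing R c)) t)

  StronglyUnitesPartial : (n : ℕ) → A → (Fin n → Maybe A) → Set
  StronglyUnitesPartial n z y =
    (∀ i {c} → y i ≡ just c → R z c) × (∀ {t} → R z t → ∀ i → CoveredPartial y i t)

module _ {A : Set} {R : A → A → Set} (reflexive : ∀ a → R a a)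
         {n : ℕ} {y : Fin n → Maybe A} (E : Enumeration y) where
  open Enumeration E

  stronglyUnites⇒stronglyUnitesPartial : ∀ {z} → Fin size →
    StronglyUnites R size z value → StronglyUnitesPartial R n z y
  stronglyUnites⇒stronglyUnitesPartial {z} k₀ united = reaches , covers
    where
    reaches : ∀ i {c} → y i ≡ just c → R z c
    reaches i yi with index-complete yi
    ... | k , refl with refl ← trans (sym (index-value k)) yi = proj₁ (united k)

    undefined-index : ∀ {i k} → y i ≡ nothing → index k ≢ i
    undefined-index {k = k} yi refl with () ← trans (sym (index-value k)) yi

    elsewhere : ∀ {i k t} → (∀ {k'} → k' ≢ k → index k' ≢ i) →
                (∃ λ k' → k' ≢ k × dia R (up R (sing R (value k'))) t) → CoveredPartial R y i t
    elsewhere avoid (k' , k'≢k , joined) = inj₂ (index k' , avoid k'≢k , value k' , index-value k' , joined)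

    undefined : ∀ {t i} → R z t → y i ≡ nothing → CoveredPartial R y i t
    undefined {t} zRt yi = [ near , elsewhere (λ _ → undefined-index yi) ] (proj₂ (united k₀) t zRt)
      where
      near : up R (sing R (value k₀)) t → CoveredPartial R y _ t
      near k₀Rt = inj₂ (index k₀ , undefined-index yi , value k₀ , index-value k₀ , t , k₀Rt , reflexive t)

    defined : ∀ {t i c} → R z t → y i ≡ just c → CoveredPartial R y i t
    defined {t} zRt yi with index-complete yi
    ... | k , refl = [ above , elsewhere (λ k'≢k → k'≢k ∘ index-injective) ] (proj₂ (united k) t zRt)
      where
      above : up R (sing R (value k)) t → CoveredPartial R y (index k) t
      above (_ , refl , kRt) = inj₁ (value k , index-value k , kRt)

    covers : ∀ {t} → R z t → ∀ i → CoveredPartial R y i t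
    covers zRt i = by-cases (y i) refl
      where
      by-cases : ∀ m → y i ≡ m → CoveredPartial R y i _
      by-cases nothing  = undefined zRt
      by-cases (just _) = defined zRt

SU≤ : ℕ → S4Frame → Set
SU≤ n F = ∀ m → 1 ≤ m → m ≤ n → SU m ⌊ F ⌋

stronglyUnitesPartial-exists : ∀ F {n} → SU≤ n F → ∀ w (y : Fin n → Maybe (W F)) →
  (∀ i {c} → y i ≡ just c → R F w c) → (∃₂ λ i c → y i ≡ just c) →
  ∃ λ z → R F w z × StronglyUnitesPartial (R F) n z y
stronglyUnitesPartial-exists F su w y wRy (_ , _ , y₀) =
  let k₀ , _           = index-complete y₀
      z , wRz , united = su size (>-nonZero⁻¹ size {{nonZeroIndex k₀}}) size≤n
                            w value (λ k → wRy (index k) (index-value k))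
  in z , wRz , stronglyUnites⇒stronglyUnitesPartial (reflR F) E k₀ united
  where
  E = enumerate y
  open Enumeration E

module _ {F₁ F₂ : S4Frame} where
  private
    R₁ = R F₁
    R₂ = R F₂
    _≺_ = ProdR F₁ F₂

  first : ProdW F₁ F₂ → Maybe (W F₁)
  first (inl c)    = just c
  first (inr _)    = nothing
  first (pair c _) = just c

  second : ProdW F₁ F₂ → Maybe (W F₂)
  second (inl _)    = nothing
  second (inr d)    = just d
  second (pair _ d) = just d

  first-monotone : ∀ {v x a c} → v ≺ x → first v ≡ just a → first x ≡ just c → R₁ a c
  first-monotone (r₁ r)   refl refl = r
  first-monotone (p₁ r)   refl refl = r
  first-monotone (pp r _) refl refl = r

  second-monotone : ∀ {v x b d} → v ≺ x → second v ≡ just b → second x ≡ just d → R₂ b d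
  second-monotone (r₂ r)   refl refl = r
  second-monotone (p₂ r)   refl refl = r
  second-monotone (pp _ r) refl refl = r

  second-inl : ∀ {a x} → inl a ≺ x → second x ≡ nothing
  second-inl (r₁ _) = refl

  first-inr : ∀ {b x} → inr b ≺ x → first x ≡ nothing
  first-inr (r₂ _) = refl

  first-of-second-nothing : ∀ {x} → second x ≡ nothing → ∃ λ c → first x ≡ just c
  first-of-second-nothing {inl c} _ = c , refl

  second-of-first-nothing : ∀ {x} → first x ≡ nothing → ∃ λ d → second x ≡ just d
  second-of-first-nothing {inr d} _ = d , refl

  first-up : ∀ {x c t} → first x ≡ just c → R₁ c t → x ≺ inl t
  first-up {inl _}    refl = r₁
  first-up {pair _ _} refl = p₁

  second-up : ∀ {x d t} → second x ≡ just d → R₂ d t → x ≺ inr t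
  second-up {inr _}    refl = r₂
  second-up {pair _ _} refl = p₂

  pair-up : ∀ {x c d t₁ t₂} → first x ≡ just c → second x ≡ just d → R₁ c t₁ → R₂ d t₂ → x ≺ pair t₁ t₂
  pair-up {pair _ _} refl refl = pp

  first-joined : ∀ {x c t v} → first x ≡ just c → (∀ {u} → R₁ t u → v ≺ inl u) →
                 dia R₁ (up R₁ (sing R₁ c)) t → dia _≺_ (up _≺_ (sing _≺_ x)) v
  first-joined xc lift (u , (_ , refl , cRu) , tRu) = inl u , (_ , refl , first-up xc cRu) , lift tRu

  second-joined : ∀ {x d t v} → second x ≡ just d → (∀ {u} → R₂ t u → v ≺ inr u) →
                  dia R₂ (up R₂ (sing R₂ d)) t → dia _≺_ (up _≺_ (sing _≺_ x)) v
  second-joined xd lift (u , (_ , refl , dRu) , tRu) = inr u , (_ , refl , second-up xd dRu) , lift tRu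

  module _ {n : ℕ} {x : Fin n → ProdW F₁ F₂} {i : Fin n} where

    cover-inl : ∀ {t} → CoveredPartial R₁ (first ∘ x) i t → Covered _≺_ x i (inl t)
    cover-inl (inj₁ (_ , xc , r))                = inj₁ (_ , refl , first-up xc r)
    cover-inl (inj₂ (j , j≢i , _ , xc , joined)) = inj₂ (j , j≢i , first-joined xc r₁ joined)

    cover-inr : ∀ {t} → CoveredPartial R₂ (second ∘ x) i t → Covered _≺_ x i (inr t)
    cover-inr (inj₁ (_ , xd , r))                = inj₁ (_ , refl , second-up xd r)
    cover-inr (inj₂ (j , j≢i , _ , xd , joined)) = inj₂ (j , j≢i , second-joined xd r₂ joined)

    cover-pair : ∀ {t₁ t₂} → CoveredPartial R₁ (first ∘ x) i t₁ → CoveredPartial R₂ (second ∘ x) i t₂ →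
                 Covered _≺_ x i (pair t₁ t₂)
    cover-pair (inj₂ (j , j≢i , _ , xc , joined)) _                                    =
      inj₂ (j , j≢i , first-joined xc p₁ joined)
    cover-pair (inj₁ _)                           (inj₂ (j , j≢i , _ , xd , joined)) =
      inj₂ (j , j≢i , second-joined xd p₂ joined)
    cover-pair (inj₁ (_ , xc , r))                (inj₁ (_ , xd , r'))               =
      inj₁ (_ , refl , pair-up xc xd r r')

  inl-reaches : ∀ {z x} → second x ≡ nothing → (∀ {c} → first x ≡ just c → R₁ z c) → inl z ≺ x
  inl-reaches {x = inl _} _ reaches = r₁ (reaches refl)

  inr-reaches : ∀ {z x} → first x ≡ nothing → (∀ {d} → second x ≡ just d → R₂ z d) → inr z ≺ x
  inr-reaches {x = inr _} _ reaches = r₂ (reaches refl)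

  pair-reaches : ∀ {z₁ z₂ x} → (∀ {c} → first x ≡ just c → R₁ z₁ c) → (∀ {d} → second x ≡ just d → R₂ z₂ d) →
                 pair z₁ z₂ ≺ x
  pair-reaches {x = inl _}    reaches₁ _        = p₁ (reaches₁ refl)
  pair-reaches {x = inr _}    _        reaches₂ = p₂ (reaches₂ refl)
  pair-reaches {x = pair _ _} reaches₁ reaches₂ = pp (reaches₁ refl) (reaches₂ refl)

  module _ {n : ℕ} {x : Fin n → ProdW F₁ F₂} where

    inl-stronglyUnites : ∀ {z} → (∀ i → second (x i) ≡ nothing) →
      StronglyUnitesPartial R₁ n z (first ∘ x) → StronglyUnites _≺_ n (inl z) x
    inl-stronglyUnites inW₁ (reaches , covers) i =
      inl-reaches (inW₁ i) (reaches i) , λ { (inl t) (r₁ r) → cover-inl (covers r i) }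

    inr-stronglyUnites : ∀ {z} → (∀ i → first (x i) ≡ nothing) →
      StronglyUnitesPartial R₂ n z (second ∘ x) → StronglyUnites _≺_ n (inr z) x
    inr-stronglyUnites inW₂ (reaches , covers) i =
      inr-reaches (inW₂ i) (reaches i) , λ { (inr t) (r₂ r) → cover-inr (covers r i) }

    pair-stronglyUnites : ∀ {z₁ z₂} → StronglyUnitesPartial R₁ n z₁ (first ∘ x) →
      StronglyUnitesPartial R₂ n z₂ (second ∘ x) → StronglyUnites _≺_ n (pair z₁ z₂) x
    pair-stronglyUnites (reaches₁ , covers₁) (reaches₂ , covers₂) i = pair-reaches (reaches₁ i) (reaches₂ i) , covered
      where
      covered : ∀ v → pair _ _ ≺ v → Covered _≺_ x i v
      covered (inl _)    (p₁ r)    = cover-inl (covers₁ r i)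
      covered (inr _)    (p₂ r)    = cover-inr (covers₂ r i)
      covered (pair _ _) (pp r r') = cover-pair (covers₁ r i) (covers₂ r' i)

    Uniting : ProdW F₁ F₂ → Set
    Uniting w = ∃ λ z → w ≺ z × StronglyUnites _≺_ n z x

    uniting-inl : SU≤ n F₁ → 1 ≤ n → ∀ {w a} → first w ≡ just a → (∀ i → w ≺ x i) →
                  (∀ i → second (x i) ≡ nothing) → Uniting w
    uniting-inl su 1≤n wa wRx inW₁ =
      let i₀               = fromℕ< 1≤n
          z , aRz , united = stronglyUnitesPartial-exists F₁ su _ (first ∘ x)
                               (λ i → first-monotone (wRx i) wa) (i₀ , first-of-second-nothing (inW₁ i₀))
      in inl z , first-up wa aRz , inl-stronglyUnites inW₁ united

    uniting-inr : SU≤ n F₂ → 1 ≤ n → ∀ {w b} → second w ≡ just b → (∀ i → w ≺ x i) →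
                  (∀ i → first (x i) ≡ nothing) → Uniting w
    uniting-inr su 1≤n wb wRx inW₂ =
      let i₀               = fromℕ< 1≤n
          z , bRz , united = stronglyUnitesPartial-exists F₂ su _ (second ∘ x)
                               (λ i → second-monotone (wRx i) wb) (i₀ , second-of-first-nothing (inW₂ i₀))
      in inr z , second-up wb bRz , inr-stronglyUnites inW₂ united

    uniting-pair : SU≤ n F₁ → SU≤ n F₂ → ∀ {a b} → (∀ i → pair a b ≺ x i) →
                   (∃₂ λ i c → first (x i) ≡ just c) → (∃₂ λ i d → second (x i) ≡ just d) → Uniting (pair a b)
    uniting-pair su₁ su₂ {a} {b} wRx some₁ some₂ =
      let z₁ , aRz₁ , united₁ = stronglyUnitesPartial-exists F₁ su₁ a (first ∘ x)
                                  (λ i → first-monotone (wRx i) refl) some₁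
          z₂ , bRz₂ , united₂ = stronglyUnitesPartial-exists F₂ su₂ b (second ∘ x)
                                  (λ i → second-monotone (wRx i) refl) some₂
      in pair z₁ z₂ , pp aRz₁ bRz₂ , pair-stronglyUnites united₁ united₂

lemma19 : (F₁ F₂ : S4Frame) (n : ℕ) → 1 ≤ n →
    (∀ (m : ℕ) → 1 ≤ m → m ≤ n → SU m ⌊ F₁ ⌋ × SU m ⌊ F₂ ⌋) →
    SU n (F₁ ⊗ F₂)
lemma19 F₁ F₂ n 1≤n su = united
  where
  su₁ : SU≤ n F₁
  su₁ m 1≤m m≤n = proj₁ (su m 1≤m m≤n)
  su₂ : SU≤ n F₂
  su₂ m 1≤m m≤n = proj₂ (su m 1≤m m≤n)

  united : SU n (F₁ ⊗ F₂)
  united (inl a) x wRx = uniting-inl su₁ 1≤n refl wRx (second-inl ∘ wRx)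
  united (inr b) x wRx = uniting-inr su₂ 1≤n refl wRx (first-inr ∘ wRx)
  united (pair a b) x wRx with all-nothing⊎some-just (second ∘ x) | all-nothing⊎some-just (first ∘ x)
  ... | inj₁ inW₁  | _          = uniting-inl su₁ 1≤n refl wRx inW₁
  ... | inj₂ _     | inj₁ inW₂  = uniting-inr su₂ 1≤n refl wRx inW₂
  ... | inj₂ some₂ | inj₂ some₁ = uniting-pair su₁ su₂ wRx some₁ some₂
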